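{- Let $\nu\geq 4$ be an integer. Then neither $K_2\vee 5K_1$ nor $K_1\vee(K_{\nu-4}\cup 3K_1)$ has a $\{K_{1,1},K_{1,2},C_m: m\geq 3\}$-factor.
   Context: All graphs are finite, simple and undirected. A $\{K_{1,1},K_{1,2},C_m: m\geq 3\}$-factor of $G$ is a spanning subgraph each of whose components is isomorphic to $K_{1,1}$ (an edge), $K_{1,2}$ (a path on three vertices), or a cycle $C_m$ with $m\geq 3$. $K_n$ is the complete graph on $n$ vertices ($K_0$ is the empty graph), $kH$ the disjoint union of $k$ copies of $H$, $\cup$ disjoint union, $\vee$ the join. -}

module Defs where

open import Data.Nat using (ℕ; zero; suc; _+_; _*_; _≤_)
open import Data.Fin using (Fin; zero; suc; splitAt; toℕ)
open import Data.Sum using (_⊎_; inj₁; inj₂)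
open import Data.Product using (Σ; ∃; ∃-syntax; _×_; _,_)
open import Data.Empty using (⊥)
open import Data.Unit using (⊤; tt)
open import Relation.Nullary using (¬_)
open import Relation.Binary.PropositionalEquality using (_≡_; refl; sym)

record Graph (n : ℕ) : Set₁ where
  field
    Adj    : Fin n → Fin n → Set
    symm   : ∀ {u v} → Adj u v → Adj v u
    irrefl : ∀ {u} → ¬ Adj u u
open Graph public

K : (n : ℕ) → Graph n
K n = record { Adj = λ u v → ¬ (u ≡ v)
             ; symm = λ ne eq → ne (sym eq)
             ; irrefl = λ ne → ne refl }

private
  blockAdj : ∀ {a b} → (Fin a → Fin a → Set) → (Fin b → Fin b → Set) → Set
           → (Fin a ⊎ Fin b) → (Fin a ⊎ Fin b) → Set
  blockAdj G H X (inj₁ u) (inj₁ v) = G u v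
  blockAdj G H X (inj₁ u) (inj₂ v) = X
  blockAdj G H X (inj₂ u) (inj₁ v) = X
  blockAdj G H X (inj₂ u) (inj₂ v) = H u v

  blockSym : ∀ {a b} (G : Graph a) (H : Graph b) (X : Set) (x y : Fin a ⊎ Fin b)
           → blockAdj (Adj G) (Adj H) X x y → blockAdj (Adj G) (Adj H) X y x
  blockSym G H X (inj₁ u) (inj₁ v) p = symm G p
  blockSym G H X (inj₁ u) (inj₂ v) p = p
  blockSym G H X (inj₂ u) (inj₁ v) p = p
  blockSym G H X (inj₂ u) (inj₂ v) p = symm H p

  blockIrr : ∀ {a b} (G : Graph a) (H : Graph b) (X : Set) (x : Fin a ⊎ Fin b)
           → ¬ blockAdj (Adj G) (Adj H) X x x
  blockIrr G H X (inj₁ u) p = irrefl G p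
  blockIrr G H X (inj₂ u) p = irrefl H p

  block : ∀ {a b} → Graph a → Graph b → Set → Graph (a + b)
  block {a} {b} G H X = record
    { Adj = λ u v → blockAdj (Adj G) (Adj H) X (splitAt a u) (splitAt a v)
    ; symm = λ {u} {v} → blockSym G H X (splitAt a u) (splitAt a v)
    ; irrefl = λ {u} → blockIrr G H X (splitAt a u) }

-- Disjoint union G ∪ H (vertices of G first, then those of H).
infixr 5 _∪_
_∪_ : ∀ {a b} → Graph a → Graph b → Graph (a + b)
G ∪ H = block G H ⊥

infixr 4 _∨_
_∨_ : ∀ {a b} → Graph a → Graph b → Graph (a + b)
G ∨ H = block G H ⊤

copies : ∀ {n} (k : ℕ) → Graph n → Graph (k * n)
copies zero    H = K 0
copies (suc k) H = H ∪ copies k H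

data Shape : Set where
  k11   : Shape
  k12   : Shape
  cycle : (m : ℕ) → 3 ≤ m → Shape

size : Shape → ℕ
size k11         = 2
size k12         = 3
size (cycle m _) = m

ShapeAdj : (s : Shape) → Fin (size s) → Fin (size s) → Set
ShapeAdj k11 u v = ¬ (u ≡ v)
ShapeAdj k12 u v = (u ≡ zero × ¬ (v ≡ zero)) ⊎ (v ≡ zero × ¬ (u ≡ zero))
ShapeAdj (cycle m _) u v = Succ u v ⊎ Succ v u
  where
    Succ : Fin m → Fin m → Set
    Succ i j = (suc (toℕ i) ≡ toℕ j) ⊎ (suc (toℕ i) ≡ m × toℕ j ≡ 0)

-- A {K_{1,1}, K_{1,2}, C_m : m ≥ 3}-factor of G: a spanning subgraph F of G
-- given as a family of k components; component i is a copy of the shape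
-- (shape i), embedded into V(G) by the injective map (emb i), whose shape
-- edges are edges of G. The copies are vertex-disjoint and cover V(G);
-- E(F) is the union of the images of the shape edges, so the components of F
-- are exactly these copies.
record Factor {n : ℕ} (G : Graph n) : Set₁ where
  field
    k        : ℕ
    shape    : Fin k → Shape
    emb      : (i : Fin k) → Fin (size (shape i)) → Fin n
    edges    : ∀ i {a b} → ShapeAdj (shape i) a b → Adj G (emb i a) (emb i b)
    injective : ∀ i {a b} → emb i a ≡ emb i b → a ≡ b
    disjoint : ∀ i j a b → emb i a ≡ emb j b → i ≡ j
    covering : ∀ v → ∃[ i ] ∃[ a ] (emb i a ≡ v)

HasFactor : ∀ {n} → Graph n → Set₁
HasFactor G = Factor G

-- In a {K_{1,1}, K_{1,2}, C_m}-factor every vertex v has a partner adjacent to it in its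
-- component (the other end of its edge, the centre of its path, or its predecessor on
-- its cycle), and a vertex is the partner of at most two vertices, which a one-bit tag
-- tells apart. So if l vertices have all their neighbours among h vertices, then
-- l ≤ 2h. In K_2 ∨ 5K_1 the five vertices of 5K_1 see only the two vertices of K_2, and
-- in K_1 ∨ (K_{ν-4} ∪ 3K_1) the three vertices of 3K_1 see only the apex.
module Submission where

open import Defs
open import Data.Nat using (ℕ; zero; suc; _+_; _*_; _<_; _≤_; _∸_)
open import Data.Nat.Properties using (n<1+n)
open import Data.Product using (_×_; _,_; proj₁; proj₂; ∃-syntax)
open import Data.Sum using (inj₁; inj₂)
open import Data.Fin using (Fin; zero; suc; fromℕ; inject₁; combine; splitAt; _↑ˡ_; _↑ʳ_)
open import Data.Fin.Properties
  using (toℕ-fromℕ; toℕ-inject₁; fromℕ≢inject₁; inject₁-injective; combine-injective;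
         splitAt-↑ʳ; splitAt⁻¹-↑ˡ; ↑ʳ-injective; <⇒notInjective)
open import Function.Definitions using (Injective)
open import Relation.Nullary using (¬_; contradiction)
open import Relation.Binary.PropositionalEquality using (_≡_; refl; sym; trans; cong; subst; module ≡-Reasoning)

cyclicPred : ∀ {m} → Fin (suc m) → Fin (suc m)
cyclicPred {m} zero = fromℕ m
cyclicPred (suc i) = inject₁ i

cyclicPred-injective : ∀ {m} → Injective _≡_ _≡_ (cyclicPred {m})
cyclicPred-injective {x = zero}  {zero}  _ = refl
cyclicPred-injective {x = zero}  {suc j} e = contradiction e fromℕ≢inject₁
cyclicPred-injective {x = suc i} {zero}  e = contradiction (sym e) fromℕ≢inject₁
cyclicPred-injective {x = suc i} {suc j} e = cong suc (inject₁-injective e)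

neighbour : (s : Shape) → Fin (size s) → Fin (size s)
neighbour k11 zero = suc zero
neighbour k11 (suc _) = zero
neighbour k12 zero = suc zero
neighbour k12 (suc _) = zero
neighbour (cycle (suc m) _) a = cyclicPred a

-- Distinguishes the two leaves of K_{1,2}, the only vertices sharing a neighbour.
tag : (s : Shape) → Fin (size s) → Fin 2
tag k12 (suc (suc _)) = suc zero
tag _   _             = zero

neighbour-adjacent : (s : Shape) (a : Fin (size s)) → ShapeAdj s a (neighbour s a)
neighbour-adjacent k11 zero = λ ()
neighbour-adjacent k11 (suc zero) = λ ()
neighbour-adjacent k12 zero = inj₁ (refl , λ ())
neighbour-adjacent k12 (suc _) = inj₂ (refl , λ ())
neighbour-adjacent (cycle (suc m) _) zero = inj₂ (inj₂ (cong suc (toℕ-fromℕ m) , refl))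
neighbour-adjacent (cycle (suc m) _) (suc i) = inj₂ (inj₁ (cong suc (toℕ-inject₁ i)))

neighbour-injective : (s : Shape) {a b : Fin (size s)} →
                      neighbour s a ≡ neighbour s b → tag s a ≡ tag s b → a ≡ b
neighbour-injective k11 {zero}       {zero}       _  _  = refl
neighbour-injective k11 {suc zero}   {suc zero}   _  _  = refl
neighbour-injective k12 {zero}       {zero}       _  _  = refl
neighbour-injective k12 {suc zero}   {suc zero}   _  _  = refl
neighbour-injective k12 {suc (suc zero)} {suc (suc zero)} _ _ = refl
neighbour-injective k12 {suc zero}   {suc (suc _)} _ ()
neighbour-injective k12 {suc (suc _)} {suc zero}  _ ()
neighbour-injective (cycle (suc m) _) e _ = cyclicPred-injective e

module _ {n : ℕ} {G : Graph n} (F : Factor G) where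
  open Factor F

  private
    component : Fin n → Fin k
    component v = proj₁ (covering v)

    position : (v : Fin n) → Fin (size (shape (component v)))
    position v = proj₁ (proj₂ (covering v))

    emb-position : (v : Fin n) → emb (component v) (position v) ≡ v
    emb-position v = proj₂ (proj₂ (covering v))

    emb-neighbour-injective :
      ∀ i j (a : Fin (size (shape i))) (b : Fin (size (shape j))) → i ≡ j →
      emb i (neighbour (shape i) a) ≡ emb j (neighbour (shape j) b) →
      tag (shape i) a ≡ tag (shape j) b → emb i a ≡ emb j b
    emb-neighbour-injective i .i a b refl e t =
      cong (emb i) (neighbour-injective (shape i) (injective i e) t)

  partner : Fin n → Fin n
  partner v = emb (component v) (neighbour (shape (component v)) (position v))

  partnerTag : Fin n → Fin 2
  partnerTag v = tag (shape (component v)) (position v)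

  partner-adjacent : (v : Fin n) → Adj G v (partner v)
  partner-adjacent v = subst (λ u → Adj G u (partner v)) (emb-position v)
                             (edges (component v) (neighbour-adjacent (shape (component v)) (position v)))

  partner-injective : ∀ {v w} → partner v ≡ partner w → partnerTag v ≡ partnerTag w → v ≡ w
  partner-injective {v} {w} e t = begin
    v                                  ≡⟨ sym (emb-position v) ⟩
    emb (component v) (position v)     ≡⟨ emb-neighbour-injective _ _ _ _ same-component e t ⟩
    emb (component w) (position w)     ≡⟨ emb-position w ⟩
    w                                  ∎
    where
    open ≡-Reasoning
    same-component : component v ≡ component w
    same-component = disjoint _ _ _ _ e

-- The necessary half of the Tutte-type criterion i(G - S) ≤ 2|S| for such factors.
small-neighbourhood⇒¬Factor :
  ∀ {n l h} {G : Graph n} (L : Fin l → Fin n) → Injective _≡_ _≡_ L →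
  (H : Fin h → Fin n) → (∀ j w → Adj G (L j) w → ∃[ i ] (H i ≡ w)) →
  2 * h < l → ¬ Factor G
small-neighbourhood⇒¬Factor {l = l} {h} L L-injective H neighbours-in-H 2h<l F =
  <⇒notInjective 2h<l code-injective
  where
  hub : Fin l → Fin h
  hub j = proj₁ (neighbours-in-H j _ (partner-adjacent F (L j)))

  hub-partner : ∀ j → H (hub j) ≡ partner F (L j)
  hub-partner j = proj₂ (neighbours-in-H j _ (partner-adjacent F (L j)))

  code : Fin l → Fin (2 * h)
  code j = combine (partnerTag F (L j)) (hub j)

  code-injective : Injective _≡_ _≡_ code
  code-injective {j} {j′} e with combine-injective _ _ _ _ e
  ... | same-tag , same-hub = L-injective (partner-injective F same-partner same-tag)
    where
    same-partner : partner F (L j) ≡ partner F (L j′)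
    same-partner = trans (sym (hub-partner j)) (trans (cong H same-hub) (hub-partner j′))

Isolated : ∀ {n} → Graph n → Fin n → Set
Isolated G u = ∀ v → ¬ Adj G u v

copies-K1-isolated : ∀ k u → Isolated (copies k (K 1)) u
copies-K1-isolated (suc k) u v with splitAt 1 u | splitAt 1 v
... | inj₁ zero | inj₁ zero = λ zero≢zero → zero≢zero refl
... | inj₁ _    | inj₂ _    = λ ()
... | inj₂ _    | inj₁ _    = λ ()
... | inj₂ u′   | inj₂ v′   = copies-K1-isolated k u′ v′

↑ʳ-isolated-∪ : ∀ {a b} (G : Graph a) (H : Graph b) {u} →
                Isolated H u → Isolated (G ∪ H) (a ↑ʳ u)
↑ʳ-isolated-∪ {a} {b} G H {u} u-isolated w rewrite splitAt-↑ʳ a b u with splitAt a w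
... | inj₁ _ = λ ()
... | inj₂ v = u-isolated v

↑ʳ-isolated-∨ : ∀ {a b} (G : Graph a) (H : Graph b) {u w} → Isolated H u →
                Adj (G ∨ H) (a ↑ʳ u) w → ∃[ i ] (i ↑ˡ b ≡ w)
↑ʳ-isolated-∨ {a} {b} G H {u} {w} u-isolated rewrite splitAt-↑ʳ a b u with splitAt a w in eq
... | inj₁ i = λ _ → i , splitAt⁻¹-↑ˡ eq
... | inj₂ v = λ u~v → contradiction u~v (u-isolated v)

K2∨5K1-¬Factor : ¬ Factor (K 2 ∨ copies 5 (K 1))
K2∨5K1-¬Factor = small-neighbourhood⇒¬Factor (2 ↑ʳ_) (↑ʳ-injective 2 _ _) (_↑ˡ 5)
  (λ j w → ↑ʳ-isolated-∨ (K 2) (copies 5 (K 1)) (copies-K1-isolated 5 j))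
  (n<1+n 4)

K1∨[Kc∪3K1]-¬Factor : ∀ c → ¬ Factor (K 1 ∨ (K c ∪ copies 3 (K 1)))
K1∨[Kc∪3K1]-¬Factor c = small-neighbourhood⇒¬Factor (λ j → 1 ↑ʳ (c ↑ʳ j))
  (λ e → ↑ʳ-injective c _ _ (↑ʳ-injective 1 _ _ e)) (_↑ˡ (c + 3))
  (λ j w → ↑ʳ-isolated-∨ (K 1) (K c ∪ copies 3 (K 1))
             (↑ʳ-isolated-∪ (K c) (copies 3 (K 1)) (copies-K1-isolated 3 j)))
  (n<1+n 2)

theorem5p1 : (ν : ℕ) → 4 ≤ ν
    → ¬ HasFactor (K 2 ∨ copies 5 (K 1))
    × ¬ HasFactor (K 1 ∨ (K (ν ∸ 4) ∪ copies 3 (K 1)))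
theorem5p1 ν _ = K2∨5K1-¬Factor , K1∨[Kc∪3K1]-¬Factor (ν ∸ 4)
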